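{- Let $k\ge3$ be odd, $t\ge0$ an integer, and $N=k^t$. Let $f_N:\{0,1\}^N\to\{0,1\}$ be the recursive majority function defined below, and let $X$ be uniformly distributed on $\{0,1\}^N$. Then $\Pr(f_N(X)=1)\le 1/2$. Moreover, $\Pr(f_N(X)=1\mid \|X\|_1=s)<1/2$ for every integer $s<N/2$.
   Context: For $j\in\{0,\dots,t\}$ and $i\in[k^{t-j}]$ let $S_i^j=\{ik^j-(k^j-1),\dots,ik^j\}\subseteq[N]$, so that $S_i^j$ is the disjoint union of $S_{ki-(k-1)}^{j-1},\dots,S_{ki}^{j-1}$. Given $\mathbf{x}\in\{0,1\}^N$: for $i\in[N]$, $S_i^0$ is activated if $\mathbf{x}_i=1$; for $j\in[t]$ and $i\in[k^{t-j}]$, $S_i^j$ is activated if at least $\frac{k+1}{2}$ of the sets $S_{ki-(k-1)}^{j-1},\dots,S_{ki}^{j-1}$ are activated. Define $f_N(\mathbf{x})=1$ if $S_1^t$ is activated and $f_N(\mathbf{x})=0$ otherwise. $\|X\|_1$ denotes the number of coordinates of $X$ equal to 1. -}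

module Defs where

open import Data.Bool using (Bool; true; false; if_then_else_)
open import Data.Nat using (ℕ; zero; suc; _+_; _*_; _^_; _≤ᵇ_)
open import Data.Nat.DivMod using (_/_)
open import Data.Vec using (Vec; []; _∷_; splitAt; head; countᵇ; map)
open import Data.List using (List; []; _∷_; _++_; length; filterᵇ)
import Data.List as L
open import Data.Product using (proj₁; proj₂)
open import Function using (id)

weight : ∀ {n} → Vec Bool n → ℕ
weight = countᵇ id

-- split a vector of length m * n into m consecutive blocks of length n
-- (block i is the i-th block of consecutive coordinates, as the sets S_i^j)
chunks : ∀ {A : Set} m n → Vec A (m * n) → Vec (Vec A n) m
chunks zero    n xs = []
chunks (suc m) n xs = proj₁ (splitAt n xs) ∷ chunks m n (proj₁ (proj₂ (splitAt n xs)))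

majority : (k : ℕ) → Vec Bool k → Bool
majority k bs = ((k + 1) / 2) ≤ᵇ weight bs

recMaj : (k t : ℕ) → Vec Bool (k ^ t) → Bool
recMaj k zero    x = head x
recMaj k (suc t) x = majority k (map (recMaj k t) (chunks k (k ^ t) x))

allVecs : (n : ℕ) → List (Vec Bool n)
allVecs zero    = [] ∷ []
allVecs (suc n) = L.map (true ∷_) (allVecs n) ++ L.map (false ∷_) (allVecs n)

countVecs : (n : ℕ) → (Vec Bool n → Bool) → ℕ
countVecs n p = length (filterᵇ p (allVecs n))

withWeight : (n s : ℕ) → Vec Bool n → Bool
withWeight n s x = Data.Nat._≡ᵇ_ (weight x) s

-- A self-dual function, f (¬ x) = ¬ f x, is 1 on exactly half of the cube.  For the
-- conditional statement let aₛ count the inputs of weight s on which f is 1 and let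
-- cₛ = C(N, s).  For monotone f the local LYM inequality aₛ (N − s) ≤ aₛ₊₁ (s + 1),
-- proved by induction on N by splitting on the first coordinate, together with
-- cₛ (N − s) = cₛ₊₁ (s + 1) makes aₛ / cₛ nondecreasing in s, strictly at every level
-- with 0 < aₛ < cₛ.  Self-duality gives a_{N−s} + aₛ = cₛ = c_{N−s}.  So for s < N / 2
-- either aₛ = 0, or aₛ / cₛ < a_{N−s} / c_{N−s}, i.e. aₛ < a_{N−s}; either way 2 aₛ < cₛ.
-- Recursive majority of odd arity is monotone and self-dual because majority is.
module Submission where

open import Data.Bool using (Bool; true; false; _∧_; not; T)
open import Data.Bool.Properties using (T-∧; ∧-identityʳ)
open import Data.Empty using (⊥-elim)
open import Data.List using ([]; _∷_; length; filterᵇ)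
import Data.List as L
open import Data.List.Properties using (filter-++; filter-≐; length-++)
open import Data.Nat
  using (ℕ; zero; suc; _+_; _*_; _^_; _∸_; _≤_; _<_; z≤n; s≤s; z<s; _≤ᵇ_; >-nonZero)
open import Data.Nat using (_≤′_; ≤′-reflexive; ≤′-step)
open import Data.Nat.DivMod using (_/_; m*n/n≡m)
open import Data.Nat.Properties
open import Algebra.Properties.CommutativeSemigroup *-commutativeSemigroup using (xy∙z≈xz∙y; x∙yz≈xz∙y)
open import Data.Nat.Tactic.RingSolver using (solve-∀)
open import Data.Product using (∃; _×_; _,_; proj₁)
open import Data.Sum using (_⊎_; inj₁; inj₂)
open import Data.Vec using (Vec; []; _∷_; map; take; drop)
open import Data.Vec.Properties using (take-map; drop-map; map-∘; map-cong)
open import Data.Vec.Relation.Binary.Pointwise.Inductive as Pw using (Pointwise; []; _∷_)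
open import Defs
open import Function using (id; _∘_; mk⇔; Equivalence)
open import Relation.Binary.PropositionalEquality
open import Relation.Nullary using (yes; no; ¬_)
open import Relation.Nullary.Decidable using (T?; ¬?; does-⇔)

split-lhs : ∀ a b c → (a + b) * suc c ≡ a * suc c + b * c + b
split-lhs = solve-∀

split-rhs : ∀ a b c → (a + b) * suc (suc c) ≡ a * suc c + b * suc (suc c) + a
split-rhs = solve-∀

2m+1≡1+m+m : ∀ m → 2 * m + 1 ≡ suc m + m
2m+1≡1+m+m = solve-∀

m≤n⇒m≡0∨m≡n∨0<m<n : ∀ {m n} → m ≤ n → m ≡ 0 ⊎ m ≡ n ⊎ (0 < m × m < n)
m≤n⇒m≡0∨m≡n∨0<m<n {zero}  _   = inj₁ refl
m≤n⇒m≡0∨m≡n∨0<m<n {suc m} m≤n with m≤n⇒m<n∨m≡n m≤n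
... | inj₁ m<n = inj₂ (inj₂ (z<s , m<n))
... | inj₂ m≡n = inj₂ (inj₁ m≡n)

0<m<n⇒n≢1 : ∀ {m n} → 0 < m → m < n → n ≢ 1
0<m<n⇒n≢1 (s≤s _) (s≤s ()) refl

+₃-mono-< : ∀ {a₁ a₂ a₃ b₁ b₂ b₃} → a₁ ≤ b₁ → a₂ ≤ b₂ → a₃ ≤ b₃ →
  a₁ < b₁ ⊎ a₂ < b₂ ⊎ a₃ < b₃ → a₁ + a₂ + a₃ < b₁ + b₂ + b₃
+₃-mono-< _   a₂≤ a₃≤ (inj₁ a₁<)        = +-mono-<-≤ (+-mono-<-≤ a₁< a₂≤) a₃≤
+₃-mono-< a₁≤ _   a₃≤ (inj₂ (inj₁ a₂<)) = +-mono-<-≤ (+-mono-≤-< a₁≤ a₂<) a₃≤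
+₃-mono-< a₁≤ a₂≤ _   (inj₂ (inj₂ a₃<)) = +-mono-≤-< (+-mono-≤ a₁≤ a₂≤) a₃<

-- a₁ * c₂ ≤ a₂ * c₁ compares the fractions a₁ / c₁ and a₂ / c₂.

cross-trans : ∀ {a₁ a₂ a₃ c₁ c₂ c₃} → 0 < c₂ →
  a₁ * c₂ ≤ a₂ * c₁ → a₂ * c₃ ≤ a₃ * c₂ → a₁ * c₃ ≤ a₃ * c₁
cross-trans {a₁} {a₂} {a₃} {c₁} {c₂} {c₃} 0<c₂ h₁₂ h₂₃ =
  *-cancelʳ-≤ (a₁ * c₃) (a₃ * c₁) c₂ {{>-nonZero 0<c₂}} (begin
    a₁ * c₃ * c₂   ≡⟨ xy∙z≈xz∙y a₁ c₃ c₂ ⟩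
    a₁ * c₂ * c₃   ≤⟨ *-monoˡ-≤ c₃ h₁₂ ⟩
    a₂ * c₁ * c₃   ≡⟨ xy∙z≈xz∙y a₂ c₁ c₃ ⟩
    a₂ * c₃ * c₁   ≤⟨ *-monoˡ-≤ c₁ h₂₃ ⟩
    a₃ * c₂ * c₁   ≡⟨ xy∙z≈xz∙y a₃ c₂ c₁ ⟩
    a₃ * c₁ * c₂   ∎)
  where open ≤-Reasoning

cross-<-≤-trans : ∀ {a₁ a₂ a₃ c₁ c₂ c₃} → 0 < c₃ →
  a₁ * c₂ < a₂ * c₁ → a₂ * c₃ ≤ a₃ * c₂ → a₁ * c₃ < a₃ * c₁
cross-<-≤-trans {a₁} {a₂} {a₃} {c₁} {c₂} {c₃} 0<c₃ h₁₂ h₂₃ =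
  *-cancelʳ-< c₂ (a₁ * c₃) (a₃ * c₁) (begin-strict
    a₁ * c₃ * c₂   ≡⟨ xy∙z≈xz∙y a₁ c₃ c₂ ⟩
    a₁ * c₂ * c₃   <⟨ *-monoˡ-< c₃ {{>-nonZero 0<c₃}} h₁₂ ⟩
    a₂ * c₁ * c₃   ≡⟨ xy∙z≈xz∙y a₂ c₁ c₃ ⟩
    a₂ * c₃ * c₁   ≤⟨ *-monoˡ-≤ c₁ h₂₃ ⟩
    a₃ * c₂ * c₁   ≡⟨ xy∙z≈xz∙y a₃ c₂ c₁ ⟩
    a₃ * c₁ * c₂   ∎)
  where open ≤-Reasoning

cross-of-absorption : ∀ {a a' c c' r s} → c * r ≡ c' * suc s →
  a * r ≤ a' * suc s → a * c' ≤ a' * c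
cross-of-absorption {a} {a'} {c} {c'} {r} {s} absorb h =
  *-cancelʳ-≤ (a * c') (a' * c) (suc s) (begin
    a * c' * suc s     ≡⟨ *-assoc a c' (suc s) ⟩
    a * (c' * suc s)   ≡⟨ cong (a *_) absorb ⟨
    a * (c * r)        ≡⟨ x∙yz≈xz∙y a c r ⟩
    a * r * c          ≤⟨ *-monoˡ-≤ c h ⟩
    a' * suc s * c     ≡⟨ xy∙z≈xz∙y a' (suc s) c ⟩
    a' * c * suc s     ∎)
  where open ≤-Reasoning

cross-of-absorption-< : ∀ {a a' c c' r s} → 0 < c → c * r ≡ c' * suc s →
  a * r < a' * suc s → a * c' < a' * c
cross-of-absorption-< {a} {a'} {c} {c'} {r} {s} 0<c absorb h =
  *-cancelʳ-< (suc s) (a * c') (a' * c) (begin-strict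
    a * c' * suc s     ≡⟨ *-assoc a c' (suc s) ⟩
    a * (c' * suc s)   ≡⟨ cong (a *_) absorb ⟨
    a * (c * r)        ≡⟨ x∙yz≈xz∙y a c r ⟩
    a * r * c          <⟨ *-monoˡ-< c {{>-nonZero 0<c}} h ⟩
    a' * suc s * c     ≡⟨ xy∙z≈xz∙y a' (suc s) c ⟩
    a' * c * suc s     ∎)
  where open ≤-Reasoning

ratio-mono : ∀ (a c : ℕ → ℕ) {n} → (∀ i → i ≤ n → 0 < c i) →
  (∀ i → i < n → a i * c (suc i) ≤ a (suc i) * c i) →
  ∀ {i k} → i ≤ k → k ≤ n → a i * c k ≤ a k * c i
ratio-mono a c pos step i≤k = go (≤⇒≤′ i≤k)
  where
  go : ∀ {i k} → i ≤′ k → k ≤ _ → a i * c k ≤ a k * c i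
  go (≤′-reflexive refl) _ = ≤-refl
  go {i} (≤′-step {k} i≤′k) 1+k≤n =
    cross-trans {a i} {a k} {a (suc k)} {c i} (pos k (<⇒≤ 1+k≤n))
      (go i≤′k (<⇒≤ 1+k≤n)) (step k 1+k≤n)

-- Counting points of the cube

length-filterᵇ-map : ∀ {A B : Set} (p : B → Bool) (g : A → B) xs →
  length (filterᵇ p (L.map g xs)) ≡ length (filterᵇ (p ∘ g) xs)
length-filterᵇ-map p g []       = refl
length-filterᵇ-map p g (x ∷ xs) with p (g x)
... | true  = cong suc (length-filterᵇ-map p g xs)
... | false = length-filterᵇ-map p g xs

length-filterᵇ-partition : ∀ {A : Set} (p q : A → Bool) xs →
  length (filterᵇ (λ x → p x ∧ q x) xs) + length (filterᵇ (λ x → p x ∧ not (q x)) xs)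
    ≡ length (filterᵇ p xs)
length-filterᵇ-partition p q []       = refl
length-filterᵇ-partition p q (x ∷ xs) with p x | q x
... | true  | true  = cong suc (length-filterᵇ-partition p q xs)
... | true  | false = trans (+-suc _ _) (cong suc (length-filterᵇ-partition p q xs))
... | false | _     = length-filterᵇ-partition p q xs

countVecs-∷ : ∀ n (p : Vec Bool (suc n) → Bool) →
  countVecs (suc n) p ≡ countVecs n (λ x → p (true ∷ x)) + countVecs n (λ x → p (false ∷ x))
countVecs-∷ n p = begin
  length (filterᵇ p (ones L.++ zeros))                  ≡⟨ cong length (filter-++ (T? ∘ p) ones zeros) ⟩
  length (filterᵇ p ones L.++ filterᵇ p zeros)          ≡⟨ length-++ (filterᵇ p ones) ⟩
  length (filterᵇ p ones) + length (filterᵇ p zeros)    ≡⟨ cong₂ _+_ (length-filterᵇ-map p (true ∷_) vs)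
                                                                     (length-filterᵇ-map p (false ∷_) vs) ⟩
  countVecs n (λ x → p (true ∷ x)) + countVecs n (λ x → p (false ∷ x)) ∎
  where
  open ≡-Reasoning
  vs    = allVecs n
  ones  = L.map (true ∷_) vs
  zeros = L.map (false ∷_) vs

countVecs-cong : ∀ n {p q : Vec Bool n → Bool} → (∀ x → p x ≡ q x) → countVecs n p ≡ countVecs n q
countVecs-cong n p≗q = cong length (filter-≐ (T? ∘ _) (T? ∘ _)
  ((λ {x} → subst T (p≗q x)) , (λ {x} → subst T (sym (p≗q x)))) (allVecs n))

countVecs-mono : ∀ n {p q : Vec Bool n → Bool} → (∀ x → T (p x) → T (q x)) →
  countVecs n p ≤ countVecs n q
countVecs-mono zero {p} {q} p⇒q with p [] | q [] | p⇒q []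
... | false | _     | _   = z≤n
... | true  | true  | _   = ≤-refl
... | true  | false | p⇒q = ⊥-elim (p⇒q _)
countVecs-mono (suc n) {p} {q} p⇒q rewrite countVecs-∷ n p | countVecs-∷ n q =
  +-mono-≤ (countVecs-mono n (p⇒q ∘ (true ∷_))) (countVecs-mono n (p⇒q ∘ (false ∷_)))

countVecs-partition : ∀ n (p q : Vec Bool n → Bool) →
  countVecs n (λ x → p x ∧ q x) + countVecs n (λ x → p x ∧ not (q x)) ≡ countVecs n p
countVecs-partition n p q = length-filterᵇ-partition p q (allVecs n)

countVecs-complement : ∀ n (p : Vec Bool n → Bool) → countVecs n (p ∘ map not) ≡ countVecs n p
countVecs-complement zero    p = countVecs-cong zero {p ∘ map not} {p} λ { [] → refl }
countVecs-complement (suc n) p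
  rewrite countVecs-∷ n (p ∘ map not) | countVecs-∷ n p
        | countVecs-complement n (λ x → p (false ∷ x)) | countVecs-complement n (λ x → p (true ∷ x)) =
  +-comm (countVecs n (λ x → p (false ∷ x))) _

countVecs-true : ∀ n → countVecs n (λ _ → true) ≡ 2 ^ n
countVecs-true zero    = refl
countVecs-true (suc n) rewrite countVecs-∷ n (λ _ → true) | countVecs-true n =
  cong (2 ^ n +_) (sym (+-identityʳ _))

countVecs-false : ∀ n → countVecs n (λ _ → false) ≡ 0
countVecs-false zero    = refl
countVecs-false (suc n) rewrite countVecs-∷ n (λ _ → false) | countVecs-false n = refl

SelfDual : ∀ {n} → (Vec Bool n → Bool) → Set
SelfDual f = ∀ x → f (map not x) ≡ not (f x)

selfDual⇒half : ∀ n {f : Vec Bool n → Bool} → SelfDual f → 2 * countVecs n f ≡ 2 ^ n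
selfDual⇒half n {f} sd = begin
  2 * countVecs n f                               ≡⟨ cong (countVecs n f +_) (+-identityʳ _) ⟩
  countVecs n f + countVecs n f                   ≡⟨ cong (countVecs n f +_) (countVecs-complement n f) ⟨
  countVecs n f + countVecs n (f ∘ map not)       ≡⟨ cong (countVecs n f +_) (countVecs-cong n sd) ⟩
  countVecs n f + countVecs n (λ x → not (f x))   ≡⟨ countVecs-partition n (λ _ → true) f ⟩
  countVecs n (λ _ → true)                        ≡⟨ countVecs-true n ⟩
  2 ^ n                                           ∎
  where open ≡-Reasoning

-- Levels of the cube

levelCount : ∀ n → (Vec Bool n → Bool) → ℕ → ℕ
levelCount n f s = countVecs n (λ x → withWeight n s x ∧ f x)

levelSize : ℕ → ℕ → ℕ
levelSize n s = countVecs n (withWeight n s)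

levelCount≤levelSize : ∀ n (f : Vec Bool n → Bool) s → levelCount n f s ≤ levelSize n s
levelCount≤levelSize n f s = countVecs-mono n (λ x → proj₁ ∘ Equivalence.to T-∧)

levelCount-true : ∀ n s → levelCount n (λ _ → true) s ≡ levelSize n s
levelCount-true n s = countVecs-cong n (λ x → ∧-identityʳ (withWeight n s x))

module _ {n} (f : Vec Bool (suc n) → Bool) where

  levelCount-∷ : ∀ s → levelCount (suc n) f (suc s)
                         ≡ levelCount n (f ∘ (true ∷_)) s + levelCount n (f ∘ (false ∷_)) (suc s)
  levelCount-∷ s = countVecs-∷ n _

  levelCount-∷-zero : levelCount (suc n) f 0 ≡ levelCount n (f ∘ (false ∷_)) 0
  levelCount-∷-zero = trans (countVecs-∷ n _) (cong (_+ levelCount n (f ∘ (false ∷_)) 0) (countVecs-false n))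

levelSize-∷ : ∀ n s → levelSize (suc n) (suc s) ≡ levelSize n s + levelSize n (suc s)
levelSize-∷ n s = countVecs-∷ n _

levelSize-zero : ∀ n → levelSize n 0 ≡ 1
levelSize-zero zero    = refl
levelSize-zero (suc n) = trans (countVecs-∷ n _) (cong₂ _+_ (countVecs-false n) (levelSize-zero n))

levelSize-vanish : ∀ n s → n < s → levelSize n s ≡ 0
levelSize-vanish zero    (suc s) _         = refl
levelSize-vanish (suc n) (suc s) (s≤s n<s) =
  trans (levelSize-∷ n s) (cong₂ _+_ (levelSize-vanish n s n<s) (levelSize-vanish n (suc s) (m<n⇒m<1+n n<s)))

levelSize-top : ∀ n → levelSize n n ≡ 1
levelSize-top zero    = refl
levelSize-top (suc n) =
  trans (levelSize-∷ n n) (cong₂ _+_ (levelSize-top n) (levelSize-vanish n (suc n) (n<1+n n)))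

levelSize-pos : ∀ n s → s ≤ n → 0 < levelSize n s
levelSize-pos n       zero    _         = subst (0 <_) (sym (levelSize-zero n)) z<s
levelSize-pos (suc n) (suc s) (s≤s s≤n) =
  subst (0 <_) (sym (levelSize-∷ n s)) (≤-trans (levelSize-pos n s s≤n) (m≤m+n _ _))

weight-complement : ∀ {n} (x : Vec Bool n) → weight (map not x) + weight x ≡ n
weight-complement []          = refl
weight-complement (true ∷ x)  = trans (+-suc _ _) (cong suc (weight-complement x))
weight-complement (false ∷ x) = cong suc (weight-complement x)

withWeight-complement : ∀ {n s s'} → s + s' ≡ n → ∀ (x : Vec Bool n) →
  withWeight n s' (map not x) ≡ withWeight n s x
withWeight-complement {n} {s} {s'} s+s'≡n x =
  does-⇔ (mk⇔ (λ w'≡s' → +-cancelˡ-≡ w' w s (trans sum (cong (_+ s) (sym w'≡s'))))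
              (λ w≡s → +-cancelʳ-≡ w w' s' (trans sum (cong (s' +_) (sym w≡s)))))
         (w' ≟ s') (w ≟ s)
  where
  w  = weight x
  w' = weight (map not x)
  sum : w' + w ≡ s' + s
  sum = trans (weight-complement x) (trans (sym s+s'≡n) (+-comm s s'))

levelCount-complement : ∀ {n s s'} → s + s' ≡ n → ∀ (f : Vec Bool n → Bool) →
  levelCount n f s' ≡ levelCount n (f ∘ map not) s
levelCount-complement {n} {s} {s'} s+s'≡n f = begin
  levelCount n f s'                                                 ≡⟨ countVecs-complement n _ ⟨
  countVecs n (λ x → withWeight n s' (map not x) ∧ f (map not x))   ≡⟨ countVecs-cong n (λ x →
                                    cong (_∧ f (map not x)) (withWeight-complement s+s'≡n x)) ⟩
  levelCount n (f ∘ map not) s                                      ∎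
  where open ≡-Reasoning

levelSize-complement : ∀ {n s s'} → s + s' ≡ n → levelSize n s' ≡ levelSize n s
levelSize-complement {n} s+s'≡n =
  trans (sym (countVecs-complement n _)) (countVecs-cong n (withWeight-complement s+s'≡n))

selfDual-levelCount : ∀ {n} {f : Vec Bool n → Bool} → SelfDual f → ∀ {s s'} → s + s' ≡ n →
  levelCount n f s' + levelCount n f s ≡ levelSize n s
selfDual-levelCount {n} {f} sd {s} {s'} s+s'≡n = begin
  levelCount n f s' + aₛ                  ≡⟨ cong (_+ aₛ) (levelCount-complement s+s'≡n f) ⟩
  levelCount n (f ∘ map not) s + aₛ       ≡⟨ cong (_+ aₛ) (countVecs-cong n λ x → cong (wₛ x ∧_) (sd x)) ⟩
  countVecs n (λ x → wₛ x ∧ not (f x)) + aₛ ≡⟨ +-comm _ aₛ ⟩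
  aₛ + countVecs n (λ x → wₛ x ∧ not (f x)) ≡⟨ countVecs-partition n wₛ f ⟩
  levelSize n s                           ∎
  where
  open ≡-Reasoning
  wₛ = withWeight n s
  aₛ = levelCount n f s

-- The local LYM inequality

_⊑_ : ∀ {n} → Vec Bool n → Vec Bool n → Set
_⊑_ = Pointwise (λ a b → T a → T b)

Monotone : ∀ {n} → (Vec Bool n → Bool) → Set
Monotone f = ∀ {x y} → x ⊑ y → T (f x) → T (f y)

module _ {n} {f : Vec Bool (suc n) → Bool} (mono : Monotone f) where

  monotone-∷ : ∀ b → Monotone (f ∘ (b ∷_))
  monotone-∷ b x⊑y = mono (id ∷ x⊑y)

  levelCount-false≤true : ∀ s → levelCount n (f ∘ (false ∷_)) s ≤ levelCount n (f ∘ (true ∷_)) s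
  levelCount-false≤true s = countVecs-mono n λ x t →
    let (w , f₀) = Equivalence.to T-∧ t in Equivalence.from T-∧ (w , mono ((λ ()) ∷ Pw.refl id) f₀)

-- Here s + r ≡ n makes r the co-level n − s.  Splitting on the first coordinate, level
-- s + 1 of f consists of level s of f₁ = f (true ∷ _) and level s + 1 of f₀ = f (false ∷ _);
-- the three summands of split-lhs / split-rhs are compared by LYM for f₁, LYM for f₀ and f₀ ≤ f₁.
localLYM : ∀ n {f : Vec Bool n → Bool} → Monotone f → ∀ s r → s + r ≡ n →
  levelCount n f s * r ≤ levelCount n f (suc s) * suc s
localLYM n       {f} _    s       zero    _  rewrite *-zeroʳ (levelCount n f s) = z≤n
localLYM zero        _    zero    (suc r) ()
localLYM zero        _    (suc s) (suc r) ()
localLYM (suc n) {f} mono zero    (suc r) eq = begin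
  levelCount (suc n) f 0 * suc r   ≡⟨ cong (_* suc r) (levelCount-∷-zero f) ⟩
  q₀ * suc r                       ≡⟨ *-suc q₀ r ⟩
  q₀ + q₀ * r                      ≤⟨ +-mono-≤ (levelCount-false≤true mono 0)
                                               (localLYM n (monotone-∷ mono false) 0 r (suc-injective eq)) ⟩
  p₀ + q₁ * 1                      ≡⟨ cong (p₀ +_) (*-identityʳ q₁) ⟩
  p₀ + q₁                          ≡⟨ *-identityʳ _ ⟨
  (p₀ + q₁) * 1                    ≡⟨ cong (_* 1) (levelCount-∷ f 0) ⟨
  levelCount (suc n) f 1 * 1       ∎
  where
  open ≤-Reasoning
  p₀ = levelCount n (f ∘ (true ∷_)) 0
  q₀ = levelCount n (f ∘ (false ∷_)) 0
  q₁ = levelCount n (f ∘ (false ∷_)) 1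
localLYM (suc n) {f} mono (suc s) (suc r) eq = begin
  levelCount (suc n) f (suc s) * suc r               ≡⟨ cong (_* suc r) (levelCount-∷ f s) ⟩
  (p + q) * suc r                                    ≡⟨ split-lhs p q r ⟩
  p * suc r + q * r + q                              ≤⟨ +-mono-≤ (+-mono-≤ p≤ q≤) q≤p' ⟩
  p' * suc s + q' * suc (suc s) + p'                 ≡⟨ split-rhs p' q' s ⟨
  (p' + q') * suc (suc s)                            ≡⟨ cong (_* suc (suc s)) (levelCount-∷ f (suc s)) ⟨
  levelCount (suc n) f (suc (suc s)) * suc (suc s)   ∎
  where
  open ≤-Reasoning
  p  = levelCount n (f ∘ (true ∷_)) s
  q  = levelCount n (f ∘ (false ∷_)) (suc s)
  p' = levelCount n (f ∘ (true ∷_)) (suc s)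
  q' = levelCount n (f ∘ (false ∷_)) (suc (suc s))
  p≤ : p * suc r ≤ p' * suc s
  p≤ = localLYM n (monotone-∷ mono true) s (suc r) (suc-injective eq)
  q≤ : q * r ≤ q' * suc (suc s)
  q≤ = localLYM n (monotone-∷ mono false) (suc s) r (trans (sym (+-suc s r)) (suc-injective eq))
  q≤p' : q ≤ p'
  q≤p' = levelCount-false≤true mono (suc s)

full⇒nonempty-above : ∀ n {f : Vec Bool n → Bool} → Monotone f → ∀ s r → s + suc r ≡ n →
  levelCount n f s ≡ levelSize n s → 0 < levelCount n f (suc s)
full⇒nonempty-above n {f} mono s r eq full = *-cancelʳ-< (suc s) 0 (levelCount n f (suc s))
  (<-≤-trans (*-monoˡ-< (suc r) 0<aₛ) (localLYM n mono s (suc r) eq))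
  where
  0<aₛ : 0 < levelCount n f s
  0<aₛ = subst (0 <_) (sym full) (levelSize-pos n s (m+n≤o⇒m≤o s (≤-reflexive eq)))

-- Levels 0 and n have a single point, so they cannot be met properly; otherwise, unless
-- one of f₁, f₀ meets its level properly, one of them is empty and the other full there,
-- and monotonicity makes the comparison f₀ ≤ f₁ or LYM for f₁ strict.
localLYM-strict : ∀ n {f : Vec Bool n → Bool} → Monotone f → ∀ s r → s + r ≡ n →
  0 < levelCount n f s → levelCount n f s < levelSize n s →
  levelCount n f s * r < levelCount n f (suc s) * suc s
localLYM-strict n       _    s       zero    eq 0<a a<c =
  ⊥-elim (0<m<n⇒n≢1 0<a a<c (subst (λ m → levelSize n m ≡ 1) n≡s (levelSize-top n)))
  where
  n≡s : n ≡ s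
  n≡s = trans (sym eq) (+-identityʳ s)
localLYM-strict n       _    zero    (suc r) _  0<a a<c = ⊥-elim (0<m<n⇒n≢1 0<a a<c (levelSize-zero n))
localLYM-strict zero    _    (suc s) (suc r) ()
localLYM-strict (suc n) {f} mono (suc s) (suc r) eq 0<a a<c = begin-strict
  levelCount (suc n) f (suc s) * suc r               ≡⟨ cong (_* suc r) (levelCount-∷ f s) ⟩
  (p + q) * suc r                                    ≡⟨ split-lhs p q r ⟩
  p * suc r + q * r + q                              <⟨ +₃-mono-< p≤ q≤ q≤p' some-strict ⟩
  p' * suc s + q' * suc (suc s) + p'                 ≡⟨ split-rhs p' q' s ⟨
  (p' + q') * suc (suc s)                            ≡⟨ cong (_* suc (suc s)) (levelCount-∷ f (suc s)) ⟨
  levelCount (suc n) f (suc (suc s)) * suc (suc s)   ∎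
  where
  open ≤-Reasoning
  f₁ = f ∘ (true ∷_)
  f₀ = f ∘ (false ∷_)
  p  = levelCount n f₁ s
  q  = levelCount n f₀ (suc s)
  p' = levelCount n f₁ (suc s)
  q' = levelCount n f₀ (suc (suc s))
  s+1+r≡n : s + suc r ≡ n
  s+1+r≡n = suc-injective eq
  1+s+r≡n : suc s + r ≡ n
  1+s+r≡n = trans (sym (+-suc s r)) s+1+r≡n
  p≤ : p * suc r ≤ p' * suc s
  p≤ = localLYM n (monotone-∷ mono true) s (suc r) s+1+r≡n
  q≤ : q * r ≤ q' * suc (suc s)
  q≤ = localLYM n (monotone-∷ mono false) (suc s) r 1+s+r≡n
  q≤p' : q ≤ p'
  q≤p' = levelCount-false≤true mono (suc s)
  some-strict : p * suc r < p' * suc s ⊎ q * r < q' * suc (suc s) ⊎ q < p'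
  some-strict with m≤n⇒m≡0∨m≡n∨0<m<n (levelCount≤levelSize n f₁ s)
                 | m≤n⇒m≡0∨m≡n∨0<m<n (levelCount≤levelSize n f₀ (suc s))
  ... | inj₂ (inj₂ (0<p , p<cp)) | _ =
    inj₁ (localLYM-strict n (monotone-∷ mono true) s (suc r) s+1+r≡n 0<p p<cp)
  ... | _ | inj₂ (inj₂ (0<q , q<cq)) =
    inj₂ (inj₁ (localLYM-strict n (monotone-∷ mono false) (suc s) r 1+s+r≡n 0<q q<cq))
  ... | inj₁ p≡0 | inj₁ q≡0 =
    ⊥-elim (<-irrefl (sym (cong₂ _+_ p≡0 q≡0)) (subst (0 <_) (levelCount-∷ f s) 0<a))
  ... | inj₂ (inj₁ p≡cp) | inj₂ (inj₁ q≡cq) =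
    ⊥-elim (<-irrefl (cong₂ _+_ p≡cp q≡cq) (subst₂ _<_ (levelCount-∷ f s) (levelSize-∷ n s) a<c))
  ... | inj₁ p≡0 | inj₂ (inj₁ q≡cq) =
    inj₁ (subst (λ m → m * suc r < p' * suc s) (sym p≡0) (*-monoˡ-< (suc s) (<-≤-trans 0<q q≤p')))
    where
    0<q : 0 < q
    0<q = subst (0 <_) (sym q≡cq) (levelSize-pos n (suc s) (m+n≤o⇒m≤o (suc s) (≤-reflexive 1+s+r≡n)))
  ... | inj₂ (inj₁ p≡cp) | inj₁ q≡0 =
    inj₂ (inj₂ (subst (_< p') (sym q≡0)
      (full⇒nonempty-above n (monotone-∷ mono true) s r s+1+r≡n p≡cp)))

levelSize-lym : ∀ n s r → s + r ≡ n → levelSize n s * r ≤ levelSize n (suc s) * suc s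
levelSize-lym n s r s+r≡n =
  subst₂ (λ c c' → c * r ≤ c' * suc s) (levelCount-true n s) (levelCount-true n (suc s))
    (localLYM n (λ _ _ → _) s r s+r≡n)

-- Both inequalities are LYM for the constant function, at level s and at level n − s − 1.
levelSize-absorb : ∀ n s r → s + r ≡ n → levelSize n s * r ≡ levelSize n (suc s) * suc s
levelSize-absorb n s zero s+0≡n = begin
  levelSize n s * 0             ≡⟨ *-zeroʳ (levelSize n s) ⟩
  0                             ≡⟨ cong (_* suc s) (levelSize-vanish n (suc s) n<1+s) ⟨
  levelSize n (suc s) * suc s   ∎
  where
  open ≡-Reasoning
  n<1+s : n < suc s
  n<1+s = s≤s (≤-reflexive (trans (sym s+0≡n) (+-identityʳ s)))
levelSize-absorb n s (suc r) s+1+r≡n = ≤-antisym (levelSize-lym n s (suc r) s+1+r≡n) (begin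
  levelSize n (suc s) * suc s   ≡⟨ cong (_* suc s) (levelSize-complement 1+s+r≡n) ⟨
  levelSize n r * suc s         ≤⟨ levelSize-lym n r (suc s) (trans (+-comm r (suc s)) 1+s+r≡n) ⟩
  levelSize n (suc r) * suc r   ≡⟨ cong (_* suc r) (levelSize-complement s+1+r≡n) ⟩
  levelSize n s * suc r         ∎)
  where
  open ≤-Reasoning
  1+s+r≡n : suc s + r ≡ n
  1+s+r≡n = trans (sym (+-suc s r)) s+1+r≡n

-- Monotone self-dual functions below the middle level

module _ {n} {f : Vec Bool n → Bool} (mono : Monotone f) {s r} (s+r≡n : s + r ≡ n) where

  levelRatio-step : levelCount n f s * levelSize n (suc s) ≤ levelCount n f (suc s) * levelSize n s
  levelRatio-step = cross-of-absorption {levelCount n f s} {levelCount n f (suc s)}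
    (levelSize-absorb n s r s+r≡n) (localLYM n mono s r s+r≡n)

  levelRatio-step-strict : 0 < levelCount n f s → levelCount n f s < levelSize n s →
    levelCount n f s * levelSize n (suc s) < levelCount n f (suc s) * levelSize n s
  levelRatio-step-strict 0<a a<c = cross-of-absorption-< {levelCount n f s} {levelCount n f (suc s)}
    (<-trans 0<a a<c) (levelSize-absorb n s r s+r≡n) (localLYM-strict n mono s r s+r≡n 0<a a<c)

module _ {n} {f : Vec Bool n → Bool} (mono : Monotone f) (sd : SelfDual f)
         {s j} (s+j≡n : s + j ≡ n) (s<j : s < j) where

  private
    a = levelCount n f
    c = levelSize n
    j≤n : j ≤ n
    j≤n = m+n≤o⇒n≤o s (≤-reflexive s+j≡n)
    0<c : ∀ i → i ≤ n → 0 < c i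
    0<c = levelSize-pos n
    cⱼ≡cₛ : c j ≡ c s
    cⱼ≡cₛ = levelSize-complement s+j≡n
    step : ∀ i → i < n → a i * c (suc i) ≤ a (suc i) * c i
    step i i<n = levelRatio-step mono (m+[n∸m]≡n (<⇒≤ i<n))

  levelCount<complement : 0 < levelCount n f s → levelCount n f s < levelCount n f j
  levelCount<complement 0<aₛ = *-cancelʳ-< (c s) (a s) (a j) (subst (λ x → a s * x < a j * c s) cⱼ≡cₛ
    (cross-<-≤-trans {a s} {a (suc s)} {a j} {c s} (0<c j j≤n)
      (levelRatio-step-strict mono s+j≡n 0<aₛ aₛ<cₛ)
      (ratio-mono a c 0<c step s<j j≤n)))
    where
    aₛ≤aⱼ : a s ≤ a j
    aₛ≤aⱼ = *-cancelʳ-≤ (a s) (a j) (c s) {{>-nonZero (0<c s (≤-trans (<⇒≤ s<j) j≤n))}}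
      (subst (λ x → a s * x ≤ a j * c s) cⱼ≡cₛ (ratio-mono a c 0<c step (<⇒≤ s<j) j≤n))
    aₛ<cₛ : a s < c s
    aₛ<cₛ = subst (a s <_) (selfDual-levelCount sd s+j≡n) (m<n+m (a s) (<-≤-trans 0<aₛ aₛ≤aⱼ))

monotone∧selfDual⇒level<half : ∀ n {f : Vec Bool n → Bool} → Monotone f → SelfDual f →
  ∀ s → 2 * s < n → 2 * levelCount n f s < levelSize n s
monotone∧selfDual⇒level<half n {f} mono sd s 2s<n with levelCount n f s ≟ 0
... | yes aₛ≡0 = subst (λ a → 2 * a < levelSize n s) (sym aₛ≡0)
                   (levelSize-pos n s (≤-trans (m≤m+n s (s + 0)) (<⇒≤ 2s<n)))
... | no aₛ≢0 = begin-strict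
  2 * a s         ≡⟨ cong (a s +_) (+-identityʳ (a s)) ⟩
  a s + a s       <⟨ +-monoʳ-< (a s) (levelCount<complement mono sd s+j≡n s<j (n≢0⇒n>0 aₛ≢0)) ⟩
  a s + a j       ≡⟨ +-comm (a s) (a j) ⟩
  a j + a s       ≡⟨ selfDual-levelCount sd s+j≡n ⟩
  levelSize n s   ∎
  where
  open ≤-Reasoning
  a = levelCount n f
  j = n ∸ s
  s<j : s < j
  s<j = m+n≤o⇒m≤o∸n (suc s) (subst (λ x → suc s + x ≤ n) (+-identityʳ s) 2s<n)
  s+j≡n : s + j ≡ n
  s+j≡n = m+[n∸m]≡n (≤-trans (<⇒≤ s<j) (m∸n≤m n s))

-- Recursive majority

module _ {A B : Set} {R : A → B → Set} where

  take⁺ : ∀ n {m} {xs : Vec A (n + m)} {ys : Vec B (n + m)} →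
    Pointwise R xs ys → Pointwise R (take n xs) (take n ys)
  take⁺ zero    _        = []
  take⁺ (suc n) (r ∷ rs) = r ∷ take⁺ n rs

  drop⁺ : ∀ n {m} {xs : Vec A (n + m)} {ys : Vec B (n + m)} →
    Pointwise R xs ys → Pointwise R (drop n xs) (drop n ys)
  drop⁺ zero    rs       = rs
  drop⁺ (suc n) (_ ∷ rs) = drop⁺ n rs

  chunks⁺ : ∀ m n {xs : Vec A (m * n)} {ys : Vec B (m * n)} →
    Pointwise R xs ys → Pointwise (Pointwise R) (chunks m n xs) (chunks m n ys)
  chunks⁺ zero    n _  = []
  chunks⁺ (suc m) n rs = take⁺ n rs ∷ chunks⁺ m n (drop⁺ n rs)

chunks-map : ∀ {A B : Set} m n (g : A → B) (xs : Vec A (m * n)) →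
  chunks m n (map g xs) ≡ map (map g) (chunks m n xs)
chunks-map zero    n g xs = refl
chunks-map (suc m) n g xs =
  cong₂ _∷_ (take-map g n xs) (trans (cong (chunks m n) (drop-map g n xs)) (chunks-map m n g (drop n xs)))

weight-mono : ∀ {n} {x y : Vec Bool n} → x ⊑ y → weight x ≤ weight y
weight-mono                             []      = z≤n
weight-mono {x = true ∷ _}  {true ∷ _}  (_ ∷ r) = s≤s (weight-mono r)
weight-mono {x = true ∷ _}  {false ∷ _} (h ∷ _) = ⊥-elim (h _)
weight-mono {x = false ∷ _} {true ∷ _}  (_ ∷ r) = m≤n⇒m≤1+n (weight-mono r)
weight-mono {x = false ∷ _} {false ∷ _} (_ ∷ r) = weight-mono r

majority-monotone : ∀ k → Monotone (majority k)
majority-monotone k x⊑y enough = ≤⇒≤ᵇ (≤-trans (≤ᵇ⇒≤ ((k + 1) / 2) _ enough) (weight-mono x⊑y))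

threshold-complement : ∀ m {w w'} → w' + w ≡ 2 * m + 1 → (suc m ≤ᵇ w') ≡ not (suc m ≤ᵇ w)
threshold-complement m {w} {w'} w'+w≡k = does-⇔ (mk⇔ not-both at-least-one) (suc m ≤? w') (¬? (suc m ≤? w))
  where
  not-both : suc m ≤ w' → ¬ suc m ≤ w
  not-both m<w' m<w = <-irrefl refl (begin-strict
    2 * m + 1         <⟨ n<1+n _ ⟩
    suc (2 * m + 1)   ≡⟨ cong suc (2m+1≡1+m+m m) ⟩
    suc (suc m + m)   ≡⟨ +-suc (suc m) m ⟨
    suc m + suc m     ≤⟨ +-mono-≤ m<w' m<w ⟩
    w' + w            ≡⟨ w'+w≡k ⟩
    2 * m + 1         ∎)
    where open ≤-Reasoning
  at-least-one : ¬ suc m ≤ w → suc m ≤ w'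
  at-least-one m≮w = +-cancelʳ-≤ w (suc m) w' (begin
    suc m + w         ≤⟨ +-monoʳ-≤ (suc m) (≤-pred (≰⇒> m≮w)) ⟩
    suc m + m         ≡⟨ 2m+1≡1+m+m m ⟨
    2 * m + 1         ≡⟨ w'+w≡k ⟨
    w' + w            ∎)
    where open ≤-Reasoning

majority-threshold : ∀ m → (2 * m + 1 + 1) / 2 ≡ suc m
majority-threshold m = trans (cong (_/ 2) (2m+2≡[1+m]*2 m)) (m*n/n≡m (suc m) 2)
  where
  2m+2≡[1+m]*2 : ∀ m → 2 * m + 1 + 1 ≡ suc m * 2
  2m+2≡[1+m]*2 = solve-∀

majority-selfDual : ∀ m → SelfDual (majority (2 * m + 1))
majority-selfDual m bs rewrite majority-threshold m =
  threshold-complement m {weight bs} {weight (map not bs)} (weight-complement bs)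

module _ (k : ℕ) where

  recMaj-monotone : ∀ t → Monotone (recMaj k t)
  recMaj-monotone zero    (x≤y ∷ []) = x≤y
  recMaj-monotone (suc t) x⊑y        =
    majority-monotone k (Pw.map⁺ (recMaj-monotone t) (chunks⁺ k (k ^ t) x⊑y))

  recMaj-selfDual : SelfDual (majority k) → ∀ t → SelfDual (recMaj k t)
  recMaj-selfDual _  zero    (b ∷ []) = refl
  recMaj-selfDual sd (suc t) x        = begin
    majority k (map g (chunks k (k ^ t) (map not x)))  ≡⟨ cong (maj ∘ map g) (chunks-map k (k ^ t) not x) ⟩
    majority k (map g (map (map not) xss))             ≡⟨ cong maj (map-∘ g (map not) xss) ⟨
    majority k (map (g ∘ map not) xss)                 ≡⟨ cong maj (map-cong (recMaj-selfDual sd t) xss) ⟩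
    majority k (map (not ∘ g) xss)                     ≡⟨ cong maj (map-∘ not g xss) ⟩
    majority k (map not (map g xss))                   ≡⟨ sd (map g xss) ⟩
    not (recMaj k (suc t) x)                           ∎
    where
    open ≡-Reasoning
    maj = majority k
    g   = recMaj k t
    xss = chunks k (k ^ t) x

lemma4p1 : (k t : ℕ) → 3 ≤ k → ∃ (λ m → k ≡ 2 * m + 1) →
    (2 * countVecs (k ^ t) (recMaj k t) ≤ 2 ^ (k ^ t))
    × ((s : ℕ) → 2 * s < k ^ t →
        2 * countVecs (k ^ t) (λ x → withWeight (k ^ t) s x ∧ recMaj k t x)
          < countVecs (k ^ t) (withWeight (k ^ t) s))
lemma4p1 .(2 * m + 1) t _ (m , refl) =
  ≤-reflexive (selfDual⇒half (k ^ t) selfDual) ,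
  monotone∧selfDual⇒level<half (k ^ t) (recMaj-monotone k t) selfDual
  where
  k = 2 * m + 1
  selfDual = recMaj-selfDual k (majority-selfDual m) t
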